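{- Let $\alpha,\beta$ be compositions of length $R$ and size $N$ with $\alpha\ne(1^R)$. Suppose that $\lambda(\alpha)=\lambda(\beta)$. If $e(\alpha)\neq e(\beta)$, then $ap(\alpha)\neq ap(\beta)$.
   Context: For a composition $\alpha=\alpha_1\cdots\alpha_R$: $\lambda(\alpha)$ is the partition obtained by sorting its parts decreasingly; $e(\alpha)$ is the multiset $\{\alpha_1,\alpha_R\}$; the adjacent pairs $ap(\alpha)$ is the multiset of multisets $\{\{\alpha_1,\alpha_2\},\{\alpha_2,\alpha_3\},\dots,\{\alpha_{R-1},\alpha_R\}\}$. -}

module Defs where

open import Data.Nat using (ℕ; zero; suc; _≤_; _⊓_; _⊔_)
open import Data.List using (List; []; _∷_; length; replicate)
open import Data.Nat.ListAction using (sum)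
open import Data.List.Relation.Unary.All using (All)
open import Data.Maybe using (Maybe; just; nothing)
open import Data.Product using (_×_; _,_)
open import Relation.Binary.PropositionalEquality using (_≡_)
open import Data.List.Relation.Binary.Permutation.Propositional using (_↭_)

IsComposition : List ℕ → Set
IsComposition α = All (1 ≤_) α

size : List ℕ → ℕ
size = sum

-- An unordered pair / 2-element multiset {a,b}, represented canonically
-- as (min, max).
UPair : Set
UPair = ℕ × ℕ

upair : ℕ → ℕ → UPair
upair a b = (a ⊓ b , a ⊔ b)

_≈ₘ_ : {A : Set} → List A → List A → Set
xs ≈ₘ ys = xs ↭ ys

-- λ(α) = λ(β) iff α and β have the same multiset of parts.
sameλ : List ℕ → List ℕ → Set
sameλ α β = α ≈ₘ β

-- e(α) = multiset {α₁, α_R}; undefined (nothing) for the empty composition.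
ends : List ℕ → Maybe UPair
ends [] = nothing
ends (a ∷ as) = just (upair a (lastOr a as))
  where
  lastOr : ℕ → List ℕ → ℕ
  lastOr x [] = x
  lastOr x (y ∷ ys) = lastOr y ys

-- ap(α): list of the adjacent unordered pairs {α_i, α_{i+1}}, compared as a multiset.
adjPairs : List ℕ → List UPair
adjPairs [] = []
adjPairs (a ∷ []) = []
adjPairs (a ∷ b ∷ rest) = upair a b ∷ adjPairs (b ∷ rest)

ones : ℕ → List ℕ
ones R = replicate R 1

module Submission where

-- Proof idea: a handshake (degree-counting) argument.
-- Read a composition α = α₁⋯α_R as a walk through the values α₁,…,α_R and
-- fix a value v.  Every entry equal to v is counted twice in total by the
-- adjacent pairs, except that the first and the last entry are each covered
-- by only one pair.  Hence, with #_v counting occurrences of v,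
--     #_v(ap α) + #_v(e α) = 2 · #_v(α)        for every value v.
-- If λ(α) = λ(β) and ap(α) = ap(β) as multisets, the identity forces
-- #_v(e α) = #_v(e β) for all v, and a two-element multiset is determined by
-- these counts, so e(α) = e(β).  The proposition is the contrapositive; it
-- in fact holds for arbitrary lists of naturals.

open import Defs
open import Data.Nat using (ℕ; _+_; _≟_)
open import Data.Nat.Properties using (≤-total; m≤n⇒m⊓n≡m; m≤n⇒m⊔n≡n; m≥n⇒m⊓n≡n; m≥n⇒m⊔n≡m; +-comm; +-cancelˡ-≡; 1+n≢0; ⊓-comm; ⊔-comm)
open import Data.Nat.ListAction using (sum)
open import Data.Nat.ListAction.Properties using (sum-↭)
open import Data.Nat.Solver using (module +-*-Solver)
open import Data.List using (List; []; _∷_; length; map)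
open import Data.List.Relation.Binary.Permutation.Propositional using (_↭_)
open import Data.List.Relation.Binary.Permutation.Propositional.Properties using (map⁺; ↭-length)
open import Data.Maybe using (Maybe; just; nothing)
open import Data.Product using (_,_)
open import Data.Sum using (inj₁; inj₂)
open import Relation.Nullary using (¬_; yes; no; contradiction)
open import Relation.Binary.PropositionalEquality using (_≡_; refl; sym; trans; cong; cong₂; module ≡-Reasoning)

open +-*-Solver using (solve; _:+_; _:=_; con)

occ : ℕ → ℕ → ℕ
occ v x with x ≟ v
... | yes _ = 1
... | no  _ = 0

occ-self : ∀ v → occ v v ≡ 1
occ-self v with v ≟ v
... | yes _   = refl
... | no  v≢v = contradiction refl v≢v

occ-other : ∀ {v x} → ¬ x ≡ v → occ v x ≡ 0
occ-other {v} {x} x≢v with x ≟ v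
... | yes x≡v = contradiction x≡v x≢v
... | no  _   = refl

occ-one : ∀ {v x} → occ v x ≡ 1 → x ≡ v
occ-one {v} {x} _ with x ≟ v
occ-one     _  | yes x≡v = x≡v
occ-one     () | no  _

count : ℕ → List ℕ → ℕ
count v xs = sum (map (occ v) xs)

pairCount : ℕ → UPair → ℕ
pairCount v (p , q) = occ v p + occ v q

pairsCount : ℕ → List UPair → ℕ
pairsCount v ps = sum (map (pairCount v) ps)

endsCount : ℕ → Maybe UPair → ℕ
endsCount v nothing  = 0
endsCount v (just p) = pairCount v p

pairCount-upair : ∀ v a b → pairCount v (upair a b) ≡ occ v a + occ v b
pairCount-upair v a b with ≤-total a b
... | inj₁ a≤b rewrite m≤n⇒m⊓n≡m a≤b | m≤n⇒m⊔n≡n a≤b = refl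
... | inj₂ b≤a rewrite m≥n⇒m⊓n≡n b≤a | m≥n⇒m⊔n≡m b≤a = +-comm (occ v b) (occ v a)

-- One step of the handshake induction: prepending a to a list with first
-- entry y and last entry ℓ adds the pair {a,y} and replaces y by a as an end.
-- Stated for an arbitrary ℓ so that the last entry never has to be named.
handshake-step : ∀ v a y ℓ D C →
  D + pairCount v (upair y ℓ) ≡ C + C →
  (pairCount v (upair a y) + D) + pairCount v (upair a ℓ) ≡ (occ v a + C) + (occ v a + C)
handshake-step v a y ℓ D C ih = begin
  (pairCount v (upair a y) + D) + pairCount v (upair a ℓ)
    ≡⟨ cong₂ (λ s t → (s + D) + t) (pairCount-upair v a y) (pairCount-upair v a ℓ) ⟩
  ((A + Y) + D) + (A + L)
    ≡⟨ solve 4 (λ A Y D L → ((A :+ Y) :+ D) :+ (A :+ L) := (A :+ A) :+ (D :+ (Y :+ L))) refl A Y D L ⟩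
  (A + A) + (D + (Y + L))
    ≡⟨ cong (λ t → (A + A) + (D + t)) (sym (pairCount-upair v y ℓ)) ⟩
  (A + A) + (D + pairCount v (upair y ℓ))
    ≡⟨ cong ((A + A) +_) ih ⟩
  (A + A) + (C + C)
    ≡⟨ solve 2 (λ A C → (A :+ A) :+ (C :+ C) := (A :+ C) :+ (A :+ C)) refl A C ⟩
  (A + C) + (A + C) ∎
  where
  open ≡-Reasoning
  A = occ v a
  Y = occ v y
  L = occ v ℓ

handshake : ∀ v α → pairsCount v (adjPairs α) + endsCount v (ends α) ≡ count v α + count v α
handshake v []          = refl
handshake v (a ∷ [])    = trans (pairCount-upair v a a)
  (solve 1 (λ A → A :+ A := (A :+ con 0) :+ (A :+ con 0)) refl (occ v a))
handshake v (a ∷ y ∷ ys) = handshake-step v a y _ _ (count v (y ∷ ys)) (handshake v (y ∷ ys))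

sum-map-↭ : ∀ {A : Set} (f : A → ℕ) {xs ys : List A} → xs ↭ ys → sum (map f xs) ≡ sum (map f ys)
sum-map-↭ f p = sum-↭ (map⁺ f p)

endsCount-determined : ∀ α β → α ↭ β → adjPairs α ↭ adjPairs β →
  ∀ v → endsCount v (ends α) ≡ endsCount v (ends β)
endsCount-determined α β parts pairs v = +-cancelˡ-≡ (pairsCount v (adjPairs α)) _ _ (begin
  pairsCount v (adjPairs α) + endsCount v (ends α) ≡⟨ handshake v α ⟩
  count v α + count v α                            ≡⟨ cong₂ _+_ sameCount sameCount ⟩
  count v β + count v β                            ≡⟨ sym (handshake v β) ⟩
  pairsCount v (adjPairs β) + endsCount v (ends β) ≡⟨ cong (_+ endsCount v (ends β)) (sym samePairs) ⟩
  pairsCount v (adjPairs α) + endsCount v (ends β) ∎)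
  where
  open ≡-Reasoning
  sameCount = sum-map-↭ (occ v) parts
  samePairs = sum-map-↭ (pairCount v) pairs

occ-matches : ∀ {v x} c → c + occ v v ≡ c + occ v x → x ≡ v
occ-matches {v} c same = occ-one (sym (trans (sym (occ-self v)) (+-cancelˡ-≡ c _ _ same)))

-- {a,x} = {b,y} as soon as every value is counted equally often: either the
-- first entries agree (then so do the second ones), or a must be y and x be b.
upair-determined : ∀ a x b y → (∀ v → occ v a + occ v x ≡ occ v b + occ v y) → upair a x ≡ upair b y
upair-determined a x b y same with b ≟ a | y ≟ a
... | yes refl | _        = cong (upair a) (sym (occ-matches (occ x a) (same x)))
... | no b≢a   | no y≢a   = contradiction aCountedOnce 1+n≢0
  where
  aCountedOnce : 1 + occ a x ≡ 0
  aCountedOnce = begin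
    1 + occ a x           ≡⟨ cong (_+ occ a x) (sym (occ-self a)) ⟩
    occ a a + occ a x     ≡⟨ same a ⟩
    occ a b + occ a y     ≡⟨ cong₂ _+_ (occ-other b≢a) (occ-other y≢a) ⟩
    0                     ∎
    where open ≡-Reasoning
... | no _     | yes refl = begin
    upair y x ≡⟨ cong (upair y) (sym (occ-matches (occ x y) (trans (same x) (+-comm (occ x b) (occ x y))))) ⟩
    upair y b ≡⟨ cong₂ _,_ (⊓-comm y b) (⊔-comm y b) ⟩
    upair b y ∎
  where open ≡-Reasoning

ends-determined : ∀ α β → sameλ α β → adjPairs α ≈ₘ adjPairs β → ends α ≡ ends β
ends-determined α β parts pairs with endsCount-determined α β parts pairs
ends-determined []       []       _ _ | _    = refl
ends-determined (a ∷ as) (b ∷ bs) _ _ | same = cong just (upair-determined a _ b _ λ v →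
  trans (sym (pairCount-upair v a _)) (trans (same v) (pairCount-upair v b _)))
ends-determined []       (_ ∷ _)  parts _ | _ with () ← ↭-length parts
ends-determined (_ ∷ _)  []       parts _ | _ with () ← ↭-length parts

proposition3p21 : (R N : ℕ) (α β : List ℕ) →
    IsComposition α → IsComposition β →
    length α ≡ R → length β ≡ R →
    size α ≡ N → size β ≡ N →
    ¬ (α ≡ ones R) →
    sameλ α β →
    ¬ (ends α ≡ ends β) →
    ¬ (adjPairs α ≈ₘ adjPairs β)
proposition3p21 R N α β _ _ _ _ _ _ _ parts differentEnds samePairs =
  differentEnds (ends-determined α β parts samePairs)
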